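{- Let $\Sigma$ be a finite alphabet, let $h:\Sigma^*\to\Sigma^*$ be a nonerasing uniform morphism prolongable on $w_0$ such that $\mathrm{alph}(h^m(a))=\mathrm{alph}(h(a))$ for all $a\in\Sigma$ and all $m\ge1$, let $\mathbf{w}=w_0w_1w_2\cdots=h^\omega(w_0)$ be aperiodic, let $\Delta\subsetneq\Sigma$, and let $(u^{(k)})_{k\ge0}$, $u^{(k)}=w_{i_k}\cdots w_{j_k}$, be a $\Delta$-sequence in $\mathbf{w}$ whose left and right stretches are constant: $\sigma^{(k)}=\sigma$ and $\rho^{(k)}=\rho$ for all $k\ge1$. Then $\lim_{k\to\infty} j_k/i_k$ exists and is rational.
   Context: $h$ is uniform if all $|h(a)|$, $a\in\Sigma$, are equal. $\mathrm{alph}(w)$ is the set of letters in $w$; aperiodic means not of the form $xy^\omega$; positions are indexed from $0$. Let $M=\max\{|h(a)|:a\in\Sigma\}$. An occurrence $w_p\cdots w_q$ is a maximal $\Delta$-block if all its letters lie in $\Delta$, $w_{q+1}\notin\Delta$, and either $p=0$ or $w_{p-1}\notin\Delta$. Since $\mathbf{w}=h(w_0)h(w_1)\cdots$, $h(w_p\cdots w_q)$ denotes the occurrence at positions $|h(w_0\cdots w_{p-1})|$ through $|h(w_0\cdots w_q)|-1$; an occurrence at positions $p..q$ contains one at $p'..q'$ if $p\le p'$, $q'\le q$. A $\Delta$-sequence is a sequence $u^{(k)}=w_{i_k}\cdots w_{j_k}$ ($k\ge0$) of maximal $\Delta$-blocks with $i_k>M$, $|u^{(k)}|>M^2$, and $h(w_{i_k+M}\cdots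 w_{j_k-M})$ contained in $u^{(k+1)}$, which is contained in $h(w_{i_k-M+1}\cdots w_{j_k+M-1})$. For $k\ge0$ let $h(w_{i_k})$ occupy positions $r_{k+1}..s_{k+1}$ and $h(w_{j_k})$ occupy positions $m_{k+1}..n_{k+1}$. The left stretch $\sigma^{(k+1)}$ is the signed word: $w_{r_{k+1}}\cdots w_{i_{k+1}-1}$, negative, if $i_{k+1}>r_{k+1}$; $w_{i_{k+1}}\cdots w_{r_{k+1}-1}$, positive, if $i_{k+1}<r_{k+1}$; $\epsilon$ if equal. The right stretch $\rho^{(k+1)}$ is: $w_{n_{k+1}+1}\cdots w_{j_{k+1}}$, positive, if $j_{k+1}>n_{k+1}$; $w_{j_{k+1}+1}\cdots w_{n_{k+1}}$, negative, if $j_{k+1}<n_{k+1}$; $\epsilon$ if equal. -}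

module Defs where

open import Data.Nat as ℕ using (ℕ; zero; suc; _+_; _*_; _∸_; _≤_; _<_; _⊔_)
open import Data.Integer using (+_)
open import Data.Rational using (ℚ; 0ℚ; _/_)
open import Data.Fin using (Fin)
open import Data.Fin.Subset using (Subset; _∈_; _∉_)
open import Data.List using (List; []; _∷_; length; map; concatMap; upTo; allFin; foldr)
open import Data.Nat.ListAction using (sum)
open import Data.Nat.Properties using (<-cmp)
open import Relation.Binary.Definitions using (tri<; tri≈; tri>)
open import Data.Product using (∃; _×_; _,_)
open import Data.Sum using (_⊎_)
open import Relation.Binary.PropositionalEquality using (_≡_; _≢_)
open import Relation.Nullary using (¬_)
open import Function using (_∘_)

Morphism : ℕ → Set
Morphism n = Fin n → List (Fin n)

ext : ∀ {n} → Morphism n → List (Fin n) → List (Fin n)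
ext h = concatMap h

iter : ∀ {n} → Morphism n → ℕ → List (Fin n) → List (Fin n)
iter h zero    u = u
iter h (suc m) u = ext h (iter h m u)

Nonerasing : ∀ {n} → Morphism n → Set
Nonerasing h = ∀ a → h a ≢ []

Uniform : ∀ {n} → Morphism n → Set
Uniform h = ∀ a b → length (h a) ≡ length (h b)

Prolongable : ∀ {n} → Morphism n → Fin n → Set
Prolongable h a = ∃ λ x → (h a ≡ a ∷ x) × (x ≢ [])

maxLen : ∀ {n} → Morphism n → ℕ
maxLen {n} h = foldr _⊔_ 0 (map (length ∘ h) (allFin n))

SameAlph : ∀ {n} → List (Fin n) → List (Fin n) → Set
SameAlph u v = ∀ b → (b ∈ₗ u → b ∈ₗ v) × (b ∈ₗ v → b ∈ₗ u)
  where open import Data.List.Membership.Propositional renaming (_∈_ to _∈ₗ_)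

Word : ℕ → Set
Word n = ℕ → Fin n

slice : ∀ {n} → Word n → ℕ → ℕ → List (Fin n)
slice w a len = map (λ t → w (a + t)) (upTo len)

IsFixedPointFrom : ∀ {n} → Morphism n → Word n → Set
IsFixedPointFrom h w =
  ∀ m → slice w 0 (length (iter h m (w 0 ∷ []))) ≡ iter h m (w 0 ∷ [])

Aperiodic : ∀ {n} → Word n → Set
Aperiodic w = ¬ (∃ λ N → ∃ λ p → (0 < p) × (∀ t → N ≤ t → w (t + p) ≡ w t))

-- hpos h w p = |h(w_0 ⋯ w_{p-1})|, the starting position of h(w_p) in w = h(w)
hpos : ∀ {n} → Morphism n → Word n → ℕ → ℕ
hpos h w p = sum (map (λ t → length (h (w t))) (upTo p))

MaxBlock : ∀ {n} → Subset n → Word n → ℕ → ℕ → Set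
MaxBlock Δ w p q =
  (p ≤ q) × (∀ t → p ≤ t → t ≤ q → w t ∈ Δ) × (w (suc q) ∉ Δ) ×
  ((p ≡ 0) ⊎ (∃ λ p' → (suc p' ≡ p) × (w p' ∉ Δ)))

-- Containment of occurrence [a..b] in [c..d] is c ≤ a and b ≤ d; the end position
-- of h(w_p ⋯ w_q) is hpos (q+1) - 1, written below as "hpos (q+1) ≤ end + 1" or "end < hpos (q+1)".
IsΔSequence : ∀ {n} → Morphism n → Subset n → Word n → (ℕ → ℕ) → (ℕ → ℕ) → Set
IsΔSequence h Δ w i j = ∀ k →
  MaxBlock Δ w (i k) (j k) ×
  (M < i k) ×
  (i k + M * M < suc (j k)) ×
  -- h(w_{i_k+M} ⋯ w_{j_k-M}) contained in u^(k+1)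
  (i (suc k) ≤ hpos h w (i k + M)) ×
  (hpos h w (suc (j k ∸ M)) ≤ suc (j (suc k))) ×
  -- u^(k+1) contained in h(w_{i_k-M+1} ⋯ w_{j_k+M-1})
  (hpos h w (i k ∸ M + 1) ≤ i (suc k)) ×
  (j (suc k) < hpos h w (j k + M ∸ 1 + 1))
  where M = maxLen h

data SignedWord (n : ℕ) : Set where
  ε   : SignedWord n
  pos : List (Fin n) → SignedWord n
  neg : List (Fin n) → SignedWord n

between : ∀ {n} → Word n → ℕ → ℕ → List (Fin n)
between w a b = slice w a (b ∸ a)

signedLeft : ∀ {n} → Word n → ℕ → ℕ → SignedWord n
signedLeft w x y with <-cmp x y
... | tri< _ _ _ = pos (between w x y)
... | tri≈ _ _ _ = ε
... | tri> _ _ _ = neg (between w y x)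

-- σ^(k+1) (as a function of k ≥ 0), with r_{k+1} = hpos (i_k):
-- i_{k+1} > r: negative w_r ⋯ w_{i_{k+1}-1}; i_{k+1} < r: positive w_{i_{k+1}} ⋯ w_{r-1}.
leftStretch : ∀ {n} → Morphism n → Word n → (ℕ → ℕ) → ℕ → SignedWord n
leftStretch h w i k = signedLeft w (i (suc k)) (hpos h w (i k))

-- ρ^(k+1), with n_{k+1} + 1 = hpos (j_k + 1):
-- j_{k+1} > n: positive w_{n+1} ⋯ w_{j_{k+1}}; j_{k+1} < n: negative w_{j_{k+1}+1} ⋯ w_n.
-- With x = j_{k+1}+1 and y = n+1 this is signedLeft with signs swapped.
flipSign : ∀ {n} → SignedWord n → SignedWord n
flipSign ε       = ε
flipSign (pos u) = neg u
flipSign (neg u) = pos u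

rightStretch : ∀ {n} → Morphism n → Word n → (ℕ → ℕ) → ℕ → SignedWord n
rightStretch h w j k = flipSign (signedLeft w (suc (j (suc k))) (hpos h w (suc (j k))))

-- a / b as a rational (b = 0 gives 0; only used with b > 0)
ratio : ℕ → ℕ → ℚ
ratio a zero    = 0ℚ
ratio a (suc b) = (+ a) / suc b

-- With a uniform morphism of length L, h(w_p) starts at position pL, so a constant
-- left stretch σ makes i_{k+1} an affine function of i_k with slope L, and a constant
-- right stretch does the same for j_k + 1. Hence i_{k+1} - i_k = D L^k and
-- j_{k+1} - j_k = E L^k, the first Δ-block containments force D = i_1 - i_0 > 0, and
-- j_k D - E i_k stays constant; as i_k → ∞ this gives j_k / i_k → E / D.

module Submission where

open import Defs
open import Data.Nat using (ℕ; suc; _≤_)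
open import Data.Fin using (Fin)
open import Data.List using (List; []; _∷_)
open import Data.Fin.Subset using (Subset; _∉_)
open import Data.Product using (∃; _×_)
open import Relation.Binary.PropositionalEquality using (_≡_)
open import Data.Rational using (ℚ; 0ℚ; ∣_∣; _-_; _<_)

open import Data.Nat as ℕ using (zero; z≤n; s≤s; _+_; _*_; _∸_; _^_; _⊔_; NonZero; >-nonZero)
open import Data.Nat.Properties
open import Data.Nat.Tactic.RingSolver using (solve-∀)
open import Data.Nat.ListAction using (sum)
open import Data.Integer as ℤ using (-[1+_]; +[1+_]; _⊖_)
import Data.Integer.Properties as ℤ
open import Data.Rational as ℚ using (mkℚ; _/_; toℚᵘ; *<*)
open import Data.Rational.Properties
  using (toℚᵘ-cancel-<; toℚᵘ-homo-∣-∣; toℚᵘ-homo-+; toℚᵘ-homo‿-; toℚᵘ-fromℚᵘ)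
open import Data.Rational.Unnormalised as ℚᵘ using (mkℚᵘ; _≃_)
import Data.Rational.Unnormalised.Properties as ℚᵘ
open import Data.List using (length; map; foldr; tabulate; upTo)
open import Data.List.Properties using (length-map; length-upTo)
open import Data.Product using (_,_)
open import Data.Sum using (inj₁; inj₂)
open import Data.Empty using (⊥-elim)
open import Relation.Binary.Definitions using (tri<; tri≈; tri>)
open import Relation.Binary.PropositionalEquality
  using (refl; sym; trans; cong; cong₂; subst; subst₂; module ≡-Reasoning)
open import Function using (_∘_)

increments-geometric : ∀ (a : ℕ → ℕ) L P Q → (∀ k → a (suc k) + P ≡ a k * L + Q) →
  a 0 ≤ a 1 → ∀ k → a (suc k) ≡ a k + (a 1 ∸ a 0) * L ^ k
increments-geometric a L P Q affine a₀≤a₁ zero =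
  trans (sym (m+[n∸m]≡n a₀≤a₁)) (cong (a 0 +_) (sym (*-identityʳ (a 1 ∸ a 0))))
increments-geometric a L P Q affine a₀≤a₁ (suc k) = +-cancelʳ-≡ P _ _ (begin
  a (2 + k) + P                 ≡⟨ affine (suc k) ⟩
  a (suc k) * L + Q             ≡⟨ cong (λ t → t * L + Q) (increments-geometric a L P Q affine a₀≤a₁ k) ⟩
  (a k + d * m) * L + Q         ≡⟨ distribute (a k) d m L Q ⟩
  (a k * L + Q) + d * (L * m)   ≡⟨ cong (_+ d * (L * m)) (affine k) ⟨
  (a (suc k) + P) + d * (L * m) ≡⟨ +-right-comm (a (suc k)) P (d * (L * m)) ⟩
  (a (suc k) + d * (L * m)) + P ∎)
  where
  open ≡-Reasoning
  d m : ℕ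
  d = a 1 ∸ a 0
  m = L ^ k
  distribute : ∀ x d m L Q → (x + d * m) * L + Q ≡ (x * L + Q) + d * (L * m)
  distribute = solve-∀
  +-right-comm : ∀ x y z → (x + y) + z ≡ (x + z) + y
  +-right-comm = solve-∀

cross-invariant : ∀ (i j : ℕ → ℕ) L D E →
  (∀ k → i (suc k) ≡ i k + D * L ^ k) → (∀ k → j (suc k) ≡ j k + E * L ^ k) →
  ∀ k → j k * D + E * i 0 ≡ E * i k + j 0 * D
cross-invariant i j L D E i-step j-step zero = +-comm (j 0 * D) (E * i 0)
cross-invariant i j L D E i-step j-step (suc k) = begin
  j (suc k) * D + E * i 0         ≡⟨ cong (λ t → t * D + E * i 0) (j-step k) ⟩
  (j k + E * m) * D + E * i 0     ≡⟨ split (j k) E m D (i 0) ⟩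
  (j k * D + E * i 0) + E * m * D ≡⟨ cong (_+ E * m * D) (cross-invariant i j L D E i-step j-step k) ⟩
  (E * i k + j 0 * D) + E * m * D ≡⟨ merge E (i k) (j 0) D m ⟩
  E * (i k + D * m) + j 0 * D     ≡⟨ cong (λ t → E * t + j 0 * D) (i-step k) ⟨
  E * i (suc k) + j 0 * D         ∎
  where
  open ≡-Reasoning
  m : ℕ
  m = L ^ k
  split : ∀ x E m D y → (x + E * m) * D + E * y ≡ (x * D + E * y) + E * m * D
  split = solve-∀
  merge : ∀ E x y D m → (E * x + y * D) + E * m * D ≡ E * (x + D * m) + y * D
  merge = solve-∀

∣m⊖n∣≤o+p : ∀ m n o p → m + o ≡ n + p → ℤ.∣ m ⊖ n ∣ ≤ o + p
∣m⊖n∣≤o+p m n o p eq with ≤-total m n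
... | inj₁ m≤n rewrite ℤ.∣⊖∣-≤ m≤n =
  ≤-trans (m≤n+o⇒m∸n≤o n m (subst (n ≤_) (sym eq) (m≤m+n n p))) (m≤m+n o p)
... | inj₂ n≤m rewrite ℤ.∣m⊖n∣≡∣n⊖m∣ m n | ℤ.∣⊖∣-≤ n≤m =
  ≤-trans (m≤n+o⇒m∸n≤o m n (subst (m ≤_) eq (m≤m+n m o))) (m≤n+m p o)

strictlyIncreasing⇒n≤f[n] : ∀ (f : ℕ → ℕ) → (∀ k → f k ℕ.< f (suc k)) → ∀ k → k ≤ f k
strictlyIncreasing⇒n≤f[n] f inc zero    = z≤n
strictlyIncreasing⇒n≤f[n] f inc (suc k) = ≤-trans (s≤s (strictlyIncreasing⇒n≤f[n] f inc k)) (inc k)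

ConvergesTo : (ℕ → ℚ) → ℚ → Set
ConvergesTo f q = ∀ ε → 0ℚ < ε → ∃ λ N → ∀ k → N ≤ k → ∣ f k - q ∣ < ε

numerator-distance : ∀ J D E I → ℤ.+ J ℤ.* ℤ.+ D ℤ.+ ℤ.- ℤ.+ E ℤ.* ℤ.+ I ≡ J * D ⊖ E * I
numerator-distance J D E I = begin
  ℤ.+ J ℤ.* ℤ.+ D ℤ.+ ℤ.- ℤ.+ E ℤ.* ℤ.+ I
    ≡⟨ cong₂ ℤ._+_ (ℤ.pos-* J D) (ℤ.neg-distribˡ-* (ℤ.+ E) (ℤ.+ I)) ⟨
  ℤ.+ (J * D) ℤ.+ ℤ.- (ℤ.+ E ℤ.* ℤ.+ I)
    ≡⟨ cong (λ t → ℤ.+ (J * D) ℤ.- t) (ℤ.pos-* E I) ⟨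
  ℤ.+ (J * D) ℤ.- ℤ.+ (E * I)
    ≡⟨ ℤ.m-n≡m⊖n (J * D) (E * I) ⟩
  J * D ⊖ E * I ∎
  where open ≡-Reasoning

toℚᵘ-∣ratio-/∣ : ∀ J I E D →
  toℚᵘ ∣ ratio J (suc I) - ℤ.+ E / suc D ∣ ≃ ℤ.+ ℤ.∣ J * suc D ⊖ E * suc I ∣ ℚᵘ./ (suc I * suc D)
toℚᵘ-∣ratio-/∣ J I E D = begin-equality
  toℚᵘ ∣ x ∣
     ≃⟨ toℚᵘ-homo-∣-∣ x ⟩
  ℚᵘ.∣ toℚᵘ x ∣
     ≃⟨ ℚᵘ.∣-∣-cong (toℚᵘ-homo-+ (ℤ.+ J / suc I) (ℚ.- (ℤ.+ E / suc D))) ⟩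
  ℚᵘ.∣ toℚᵘ (ℤ.+ J / suc I) ℚᵘ.+ toℚᵘ (ℚ.- (ℤ.+ E / suc D)) ∣
     ≃⟨ ℚᵘ.∣-∣-cong (ℚᵘ.+-cong (toℚᵘ-fromℚᵘ (mkℚᵘ (ℤ.+ J) I))
          (ℚᵘ.≃-trans (toℚᵘ-homo‿- (ℤ.+ E / suc D)) (ℚᵘ.-‿cong (toℚᵘ-fromℚᵘ (mkℚᵘ (ℤ.+ E) D))))) ⟩
  ℚᵘ.∣ mkℚᵘ (ℤ.+ J) I ℚᵘ.- mkℚᵘ (ℤ.+ E) D ∣
     ≡⟨ cong (λ t → ℤ.+ ℤ.∣ t ∣ ℚᵘ./ (suc I * suc D)) (numerator-distance J (suc D) E (suc I)) ⟩
  ℤ.+ ℤ.∣ J * suc D ⊖ E * suc I ∣ ℚᵘ./ (suc I * suc D) ∎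
  where
  open ℚᵘ.≤-Reasoning
  x : ℚ
  x = ℤ.+ J / suc I - ℤ.+ E / suc D

cross-bounded⇒ratio-converges : ∀ (i j : ℕ → ℕ) E D B →
  (∀ k → ℤ.∣ j k * suc D ⊖ E * i k ∣ ≤ B) → (∀ k → k ≤ i k) →
  ConvergesTo (λ k → ratio (j k) (i k)) (ℤ.+ E / suc D)
cross-bounded⇒ratio-converges i j E D B close unbounded (mkℚ (ℤ.+ zero) _ _) (*<* (ℤ.+<+ ()))
cross-bounded⇒ratio-converges i j E D B close unbounded (mkℚ -[1+ _ ] _ _) (*<* ())
cross-bounded⇒ratio-converges i j E D B close unbounded (mkℚ +[1+ e ] d c) _ =
  suc (B * suc d) , λ k N≤k → within (j k) (i k) (close k) (≤-trans N≤k (unbounded k))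
  where
  within : ∀ J I → ℤ.∣ J * suc D ⊖ E * I ∣ ≤ B → B * suc d ℕ.< I →
    ∣ ratio J I - ℤ.+ E / suc D ∣ < mkℚ +[1+ e ] d c
  within J (suc I) close lt =
    toℚᵘ-cancel-< (ℚᵘ.<-respˡ-≃ (ℚᵘ.≃-sym (toℚᵘ-∣ratio-/∣ J I E D)) (ℚᵘ.*<*
      (subst₂ ℤ._<_ (ℤ.pos-* ℤ.∣ J * suc D ⊖ E * suc I ∣ (suc d)) (ℤ.pos-* (suc e) (suc I * suc D))
        (ℤ.+<+ (begin-strict
          ℤ.∣ J * suc D ⊖ E * suc I ∣ * suc d ≤⟨ *-monoˡ-≤ (suc d) close ⟩
          B * suc d                            <⟨ lt ⟩
          suc I                                ≤⟨ m≤m*n (suc I) (suc D) ⟩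
          suc I * suc D                        ≤⟨ m≤n*m (suc I * suc D) (suc e) ⟩
          suc e * (suc I * suc D)              ∎)))))
    where open ≤-Reasoning

geometric-ratio-converges : ∀ (i j : ℕ → ℕ) L D E → .{{_ : NonZero L}} → .{{_ : NonZero D}} →
  (∀ k → i (suc k) ≡ i k + D * L ^ k) → (∀ k → j (suc k) ≡ j k + E * L ^ k) →
  ConvergesTo (λ k → ratio (j k) (i k)) (ℤ.+ E / D)
geometric-ratio-converges i j L (suc D) E i-step j-step =
  cross-bounded⇒ratio-converges i j E D (E * i 0 + j 0 * suc D)
    (λ k → ∣m⊖n∣≤o+p (j k * suc D) (E * i k) (E * i 0) (j 0 * suc D)
             (cross-invariant i j L (suc D) E i-step j-step k))
    (strictlyIncreasing⇒n≤f[n] i increasing)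
  where
  increasing : ∀ k → i k ℕ.< i (suc k)
  increasing k = subst (i k ℕ.<_) (sym (i-step k))
    (m<m+n (i k) (<-≤-trans (m^n>0 L k) (m≤n*m (L ^ k) (suc D))))

sum-map-const : ∀ {A : Set} (g : A → ℕ) {L} → (∀ x → g x ≡ L) → ∀ xs → sum (map g xs) ≡ length xs * L
sum-map-const g gx≡L []       = refl
sum-map-const g gx≡L (x ∷ xs) = cong₂ _+_ (gx≡L x) (sum-map-const g gx≡L xs)

foldr-⊔-map-const : ∀ {A : Set} (g : A → ℕ) {L} → (∀ x → g x ≡ L) →
  ∀ x xs → foldr _⊔_ 0 (map g (x ∷ xs)) ≡ L
foldr-⊔-map-const g {L} gx≡L x xs = trans (cong (_⊔ _) (gx≡L x)) (m≥n⇒m⊔n≡m (bounded xs))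
  where
  bounded : ∀ xs → foldr _⊔_ 0 (map g xs) ≤ L
  bounded []       = z≤n
  bounded (y ∷ ys) = ⊔-lub (≤-reflexive (gx≡L y)) (bounded ys)

uniform⇒hpos≡* : ∀ {n} (h : Morphism n) → Uniform h → ∀ a w p → hpos h w p ≡ p * length (h a)
uniform⇒hpos≡* h uniform a w p = begin
  hpos h w p
    ≡⟨ sum-map-const (λ t → length (h (w t))) (λ t → uniform (w t) a) (upTo p) ⟩
  length (upTo p) * length (h a)
    ≡⟨ cong (_* length (h a)) (length-upTo p) ⟩
  p * length (h a) ∎
  where open ≡-Reasoning

uniform⇒maxLen≡ : ∀ {n} (h : Morphism n) → Uniform h → ∀ a → maxLen h ≡ length (h a)
uniform⇒maxLen≡ {zero}  h uniform ()
uniform⇒maxLen≡ {suc _} h uniform a =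
  foldr-⊔-map-const (length ∘ h) (λ b → uniform b a) Data.Fin.zero (tabulate Data.Fin.suc)

prolongable⇒2≤length : ∀ {n} (h : Morphism n) a → Prolongable h a → 2 ≤ length (h a)
prolongable⇒2≤length h a (_ ∷ _ , ha≡ax , _) rewrite ha≡ax = s≤s (s≤s z≤n)
prolongable⇒2≤length h a ([]    , _     , x≢[]) = ⊥-elim (x≢[] refl)

∣_∣⁺ ∣_∣⁻ : ∀ {n} → SignedWord n → ℕ
∣ pos u ∣⁺ = length u
∣ _     ∣⁺ = 0
∣ neg u ∣⁻ = length u
∣ _     ∣⁻ = 0

∣flipSign∣⁺ : ∀ {n} (s : SignedWord n) → ∣ flipSign s ∣⁺ ≡ ∣ s ∣⁻
∣flipSign∣⁺ ε       = refl
∣flipSign∣⁺ (pos u) = refl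
∣flipSign∣⁺ (neg u) = refl

∣flipSign∣⁻ : ∀ {n} (s : SignedWord n) → ∣ flipSign s ∣⁻ ≡ ∣ s ∣⁺
∣flipSign∣⁻ ε       = refl
∣flipSign∣⁻ (pos u) = refl
∣flipSign∣⁻ (neg u) = refl

length-between : ∀ {n} (w : Word n) a b → length (between w a b) ≡ b ∸ a
length-between w a b = trans (length-map _ (upTo (b ∸ a))) (length-upTo (b ∸ a))

signedLeft-balance : ∀ {n} (w : Word n) x y → x + ∣ signedLeft w x y ∣⁺ ≡ y + ∣ signedLeft w x y ∣⁻
signedLeft-balance w x y with <-cmp x y
... | tri< x<y _ _ = begin
  x + length (between w x y) ≡⟨ cong (x +_) (length-between w x y) ⟩
  x + (y ∸ x)                ≡⟨ m+[n∸m]≡n (<⇒≤ x<y) ⟩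
  y                          ≡⟨ +-identityʳ y ⟨
  y + 0                      ∎
  where open ≡-Reasoning
... | tri≈ _ x≡y _ = cong (_+ 0) x≡y
... | tri> _ _ y<x = begin
  x + 0                      ≡⟨ +-identityʳ x ⟩
  x                          ≡⟨ m+[n∸m]≡n (<⇒≤ y<x) ⟨
  y + (x ∸ y)                ≡⟨ cong (y +_) (length-between w y x) ⟨
  y + length (between w y x) ∎
  where open ≡-Reasoning

module _ {n} (h : Morphism n) (w : Word n) {L} (hpos≡* : ∀ p → hpos h w p ≡ p * L) where

  constant-leftStretch⇒affine : ∀ i {σ} → (∀ k → leftStretch h w i k ≡ σ) →
    ∀ k → i (suc k) + ∣ σ ∣⁺ ≡ i k * L + ∣ σ ∣⁻
  constant-leftStretch⇒affine i σ-const k =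
    subst (λ s → i (suc k) + ∣ s ∣⁺ ≡ i k * L + ∣ s ∣⁻) (σ-const k)
      (trans (signedLeft-balance w (i (suc k)) (hpos h w (i k)))
             (cong (_+ ∣ leftStretch h w i k ∣⁻) (hpos≡* (i k))))

  constant-rightStretch⇒affine : ∀ j {ρ} → (∀ k → rightStretch h w j k ≡ ρ) →
    ∀ k → suc (j (suc k)) + ∣ ρ ∣⁻ ≡ suc (j k) * L + ∣ ρ ∣⁺
  constant-rightStretch⇒affine j ρ-const k =
    subst (λ s → suc (j (suc k)) + ∣ s ∣⁻ ≡ suc (j k) * L + ∣ s ∣⁺) (ρ-const k) (begin
      suc (j (suc k)) + ∣ flipSign s ∣⁻ ≡⟨ cong (suc (j (suc k)) +_) (∣flipSign∣⁻ s) ⟩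
      suc (j (suc k)) + ∣ s ∣⁺          ≡⟨ signedLeft-balance w (suc (j (suc k))) (hpos h w (suc (j k))) ⟩
      hpos h w (suc (j k)) + ∣ s ∣⁻     ≡⟨ cong₂ _+_ (hpos≡* (suc (j k))) (sym (∣flipSign∣⁺ s)) ⟩
      suc (j k) * L + ∣ flipSign s ∣⁺   ∎)
    where
    open ≡-Reasoning
    s : SignedWord n
    s = signedLeft w (suc (j (suc k))) (hpos h w (suc (j k)))

1+m≤[1+m∸n]*n : ∀ m n → 2 ≤ n → n ℕ.< m → suc m ≤ suc (m ∸ n) * n
1+m≤[1+m∸n]*n m n 2≤n n<m = begin
  suc m       ≡⟨ cong suc (m+[n∸m]≡n (<⇒≤ n<m)) ⟨
  suc (n + d) ≡⟨ +-suc n d ⟨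
  n + suc d   ≤⟨ +-monoʳ-≤ n (m<m+n d (m<n⇒0<n∸m n<m)) ⟩
  n + (d + d) ≡⟨ cong (λ t → n + (d + t)) (+-identityʳ d) ⟨
  n + 2 * d   ≡⟨ cong (n +_) (*-comm 2 d) ⟩
  n + d * 2   ≤⟨ +-monoʳ-≤ n (*-monoʳ-≤ d 2≤n) ⟩
  n + d * n   ∎
  where
  open ≤-Reasoning
  d : ℕ
  d = m ∸ n

uniform-ΔSequence-start : ∀ {n} (h : Morphism n) {Δ w i j} → Uniform h → Prolongable h (w 0) →
  IsΔSequence h Δ w i j → i 0 ℕ.< i 1 × j 0 ≤ j 1
uniform-ΔSequence-start h {w = w} {i} {j} uniform prolongable Δ-seq with Δ-seq 0
... | (i₀≤j₀ , _) , M<i₀ , _ , _ , hpos[1+j₀-M]≤1+j₁ , hpos[i₀-M+1]≤i₁ , _ = i₀<i₁ , j₀≤j₁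
  where
  open ≤-Reasoning
  L : ℕ
  L = length (h (w 0))
  M≡L : maxLen h ≡ L
  M≡L = uniform⇒maxLen≡ h uniform (w 0)
  hpos≡* : ∀ p → hpos h w p ≡ p * L
  hpos≡* = uniform⇒hpos≡* h uniform (w 0) w
  2≤L : 2 ≤ L
  2≤L = prolongable⇒2≤length h (w 0) prolongable
  L<i₀ : L ℕ.< i 0
  L<i₀ = subst (ℕ._< i 0) M≡L M<i₀
  i₀<i₁ : i 0 ℕ.< i 1
  i₀<i₁ = begin
    suc (i 0)                     ≤⟨ 1+m≤[1+m∸n]*n (i 0) L 2≤L L<i₀ ⟩
    suc (i 0 ∸ L) * L             ≡⟨ cong (_* L) (+-comm 1 (i 0 ∸ L)) ⟩
    (i 0 ∸ L + 1) * L             ≡⟨ cong (λ t → (i 0 ∸ t + 1) * L) M≡L ⟨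
    (i 0 ∸ maxLen h + 1) * L      ≡⟨ hpos≡* (i 0 ∸ maxLen h + 1) ⟨
    hpos h w (i 0 ∸ maxLen h + 1) ≤⟨ hpos[i₀-M+1]≤i₁ ⟩
    i 1                           ∎
  j₀≤j₁ : j 0 ≤ j 1
  j₀≤j₁ = ≤-pred (begin
    suc (j 0)                       ≤⟨ 1+m≤[1+m∸n]*n (j 0) L 2≤L (<-≤-trans L<i₀ i₀≤j₀) ⟩
    suc (j 0 ∸ L) * L               ≡⟨ cong (λ t → suc (j 0 ∸ t) * L) M≡L ⟨
    suc (j 0 ∸ maxLen h) * L        ≡⟨ hpos≡* (suc (j 0 ∸ maxLen h)) ⟨
    hpos h w (suc (j 0 ∸ maxLen h)) ≤⟨ hpos[1+j₀-M]≤1+j₁ ⟩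
    suc (j 1)                       ∎)

lemma18 : ∀ {n} (h : Morphism n) (w : Word n) (Δ : Subset n)
    (i j : ℕ → ℕ) (σ ρ : SignedWord n) →
    Nonerasing h → Uniform h → Prolongable h (w 0) →
    (∀ a m → 1 ≤ m → SameAlph (iter h m (a ∷ [])) (h a)) →
    IsFixedPointFrom h w → Aperiodic w →
    (∃ λ c → c ∉ Δ) →
    IsΔSequence h Δ w i j →
    (∀ k → leftStretch h w i k ≡ σ) →
    (∀ k → rightStretch h w j k ≡ ρ) →
    ∃ λ (q : ℚ) → ∀ (ε : ℚ) → 0ℚ < ε →
      ∃ λ N → ∀ k → N ≤ k → ∣ ratio (j k) (i k) - q ∣ < ε
lemma18 h w Δ i j σ ρ _ uniform prolongable _ _ _ _ Δ-seq σ-const ρ-const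
  with uniform-ΔSequence-start h uniform prolongable Δ-seq
... | i₀<i₁ , j₀≤j₁ = ℤ.+ E / D , geometric-ratio-converges i j L D E i-step j-step
  where
  L D E : ℕ
  L = length (h (w 0))
  D = i 1 ∸ i 0
  E = j 1 ∸ j 0
  instance
    L≢0 : NonZero L
    L≢0 = >-nonZero (≤-trans (s≤s z≤n) (prolongable⇒2≤length h (w 0) prolongable))
    D≢0 : NonZero D
    D≢0 = >-nonZero (m<n⇒0<n∸m i₀<i₁)
  hpos≡* : ∀ p → hpos h w p ≡ p * L
  hpos≡* = uniform⇒hpos≡* h uniform (w 0) w
  i-step : ∀ k → i (suc k) ≡ i k + D * L ^ k
  i-step = increments-geometric i L _ _
    (constant-leftStretch⇒affine h w hpos≡* i σ-const) (<⇒≤ i₀<i₁)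
  j-step : ∀ k → j (suc k) ≡ j k + E * L ^ k
  j-step k = suc-injective (increments-geometric (suc ∘ j) L _ _
    (constant-rightStretch⇒affine h w hpos≡* j ρ-const) (s≤s j₀≤j₁) k)
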